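{- For every $n\in\mathbb{N}$, there exists a convex geometric graph $G$ with $n$ vertices and $O(n\log n)$ edges that is universal for $n$-vertex caterpillars.
   Context: A geometric graph is a graph together with a straight-line drawing in the plane in which the vertices are distinct points and the edges are straight-line segments not containing any vertex in their interiors; it is convex if its vertices are in convex position. An embedding of an abstract graph $H$ into a geometric graph $G$ is an injective map $\phi:V(H)\to V(G)$ such that every edge $uv$ of $H$ is mapped to a segment $\phi(u)\phi(v)$ that is an edge of $G$, and any two edges of $H$ are mapped to non-crossing segments. A geometric graph is universal for a class $\mathcal H$ if it contains an embedding of every graph in $\mathcal H$. A caterpillar is a tree such that removing all its leaves results in a path. -}

module Defs where

open import Data.Nat as ℕ using (ℕ; _∸_)
open import Data.Fin using (Fin; toℕ; _≟_)
open import Data.Fin as F using ()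
open import Data.Product using (Σ; _×_; _,_; proj₁; proj₂; ∃-syntax)
open import Data.Sum using (_⊎_)
open import Data.List using (List; []; _∷_; length; filter)
open import Data.List.Membership.Propositional using (_∈_)
open import Data.List.Relation.Unary.All using (All)
open import Data.List.Relation.Unary.Unique.Propositional using (Unique)
open import Relation.Binary.PropositionalEquality using (_≡_)
open import Relation.Nullary using (¬_)
open import Relation.Nullary.Decidable using (_⊎-dec_)
open import Function.Definitions using (Injective)

-- A simple graph on vertex set Fin n, given by its list of edges {a,b},
-- each stored once as an ordered pair (a , b) with a < b.
record Graph (n : ℕ) : Set where
  field
    edges   : List (Fin n × Fin n)
    ordered : All (λ e → proj₁ e F.< proj₂ e) edges
    unique  : Unique edges
open Graph public

numEdges : ∀ {n} → Graph n → ℕ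
numEdges G = length (edges G)

Adj : ∀ {n} → Graph n → Fin n → Fin n → Set
Adj G u v = ((u , v) ∈ edges G) ⊎ ((v , u) ∈ edges G)

data Walk {n} (G : Graph n) : Fin n → Fin n → Set where
  here : ∀ {v} → Walk G v v
  step : ∀ {u w v} → Adj G u w → Walk G w v → Walk G u v

Connected : ∀ {n} → Graph n → Set
Connected G = ∀ u v → Walk G u v

IsTree : ∀ {n} → Graph n → Set
IsTree {n} G = Connected G × (numEdges G ≡ n ∸ 1)

degree : ∀ {n} → Graph n → Fin n → ℕ
degree G v = length (filter (λ e → (proj₁ e ≟ v) ⊎-dec (proj₂ e ≟ v)) (edges G))

Leaf : ∀ {n} → Graph n → Fin n → Set
Leaf G v = degree G v ≡ 1

data Consec {A : Set} : List A → A → A → Set where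
  now  : ∀ {x y xs} → Consec (x ∷ y ∷ xs) x y
  later : ∀ {x xs a b} → Consec xs a b → Consec (x ∷ xs) a b

-- The graph obtained from G by deleting all leaves is a path:
-- its vertex set (the non-leaves) can be listed without repetition as
-- L = v₁,…,v_k such that two non-leaves are adjacent iff they are
-- consecutive in L (the empty graph counts as the empty path).
LeafDeletionIsPath : ∀ {n} → Graph n → Set
LeafDeletionIsPath {n} G =
  Σ (List (Fin n)) λ L →
    Unique L ×
    (∀ v → (v ∈ L) → ¬ Leaf G v) ×
    (∀ v → ¬ Leaf G v → v ∈ L) ×
    (∀ u v → u ∈ L → v ∈ L → (Adj G u v → (Consec L u v ⊎ Consec L v u))
                            × ((Consec L u v ⊎ Consec L v u) → Adj G u v))

IsCaterpillar : ∀ {n} → Graph n → Set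
IsCaterpillar G = IsTree G × LeafDeletionIsPath G

-- Convex geometric graphs: vertices in convex position are labelled
-- 0,…,n-1 in their cyclic (e.g. counterclockwise) order.  Two segments
-- ab and cd then cross iff their endpoints are four distinct points that
-- interleave in this cyclic order, i.e. exactly one of c,d lies strictly
-- between min(a,b) and max(a,b) and the other strictly outside.
Between : ∀ {n} → Fin n → Fin n → Fin n → Set
Between a b x = (toℕ x ℕ.> toℕ a ℕ.⊓ toℕ b) × (toℕ x ℕ.< toℕ a ℕ.⊔ toℕ b)

Outside : ∀ {n} → Fin n → Fin n → Fin n → Set
Outside a b x = (toℕ x ℕ.< toℕ a ℕ.⊓ toℕ b) ⊎ (toℕ x ℕ.> toℕ a ℕ.⊔ toℕ b)

Cross : ∀ {n} → Fin n → Fin n → Fin n → Fin n → Set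
Cross a b c d = (Between a b c × Outside a b d) ⊎ (Outside a b c × Between a b d)

Embeds : ∀ {n} → Graph n → Graph n → Set
Embeds {n} H G =
  Σ (Fin n → Fin n) λ φ →
    Injective _≡_ _≡_ φ ×
    (∀ {a b} → (a , b) ∈ edges H → Adj G (φ a) (φ b)) ×
    (∀ {a b c d} → (a , b) ∈ edges H → (c , d) ∈ edges H →
       ¬ Cross (φ a) (φ b) (φ c) (φ d))

UniversalForCaterpillars : ∀ {n} → Graph n → Set
UniversalForCaterpillars {n} G = (H : Graph n) → IsCaterpillar H → Embeds H G

-- Let G be the graph on 0,…,n-1 in which the middle vertex of [0,n) is joined to every other
-- vertex and the two halves are treated recursively; it has at most n⌈log₂ n⌉ edges.  Every
-- interval [a,b) contains a hub adjacent to all its other vertices (the first recursion midpoint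
-- falling into it), and the hubs of two adjacent intervals are adjacent.
-- To embed a caterpillar with spine v₀,…,v_k, cut 0,…,n-1 into consecutive blocks, block i of
-- size 1 + #leaves of vᵢ; put vᵢ on the hub of block i and its leaves on the rest of the block.
-- Spine edges join hubs of adjacent blocks and leaf edges end at the hub of their block.  Two
-- edges whose block ranges overlap therefore share a hub endpoint, and otherwise they are
-- separated, so no two edges cross.

module Submission where

open import Defs
open import Data.Nat
  using (ℕ; zero; suc; _+_; _*_; _∸_; _≤_; _<_; _⊓_; _⊔_; _≟_; _≤?_; _<?_; z≤n; s≤s; s≤s⁻¹; ⌊_/2⌋; ⌈_/2⌉)
open import Data.Nat.Properties
open import Data.Nat.Logarithm using (⌈log₂_⌉; ⌈log₂⌉-mono-≤; ⌈log₂⌈n/2⌉⌉≡⌈log₂n⌉∸1)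
open import Data.Fin as F using (Fin; toℕ; fromℕ<)
open import Data.Fin.Properties using (toℕ<n; toℕ-injective; toℕ-fromℕ<; fromℕ<-toℕ)
open import Data.Product using (Σ; _×_; _,_; proj₁; proj₂; ∃-syntax; map₁)
open import Data.Product.Properties using (≡-dec)
open import Data.Product.Relation.Binary.Lex.Strict using (×-strictTotalOrder)
open import Data.Sum using (_⊎_; inj₁; inj₂; swap; [_,_]) renaming (map to ⊎-map)
open import Data.Empty using (⊥; ⊥-elim)
open import Data.Vec using (Vec; []; _∷_; count; allFin)
open import Data.Vec.Properties using (count≤n)
open import Data.Vec.Membership.Propositional using () renaming (_∈_ to _∈ᵥ_)
open import Data.Vec.Membership.Propositional.Properties using (∈-allFin⁺)
open import Data.Vec.Relation.Unary.Any using (here; there)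
open import Data.List using (List; []; _∷_; _++_; length; map; filter; applyUpTo; deduplicate)
open import Data.List.Properties using (length-++; length-map; length-applyUpTo; length-deduplicate)
open import Data.List.Membership.Propositional using (_∈_; _∉_)
open import Data.List.Membership.Propositional.Properties
  using (∈-map⁺; ∈-applyUpTo⁺; ∈-deduplicate⁺; ∈-filter⁺; ∈-filter⁻)
open import Data.List.Membership.Propositional.Properties.WithK using (unique⇒irrelevant)
open import Data.List.Membership.Setoid.Properties using (index-injective)
open import Data.List.Relation.Binary.Subset.Propositional using (_⊆_)
open import Data.List.Relation.Binary.Subset.Propositional.Properties using (xs⊆xs++ys; xs⊆ys++xs)
open import Data.List.Relation.Unary.Any as Any using (here; there)
open import Data.List.Relation.Unary.All as All using (All; []; _∷_)
open import Data.List.Relation.Unary.All.Properties using (deduplicate⁺)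
open import Data.List.Relation.Unary.Unique.Propositional using (Unique)
open import Data.List.Relation.Unary.Unique.DecPropositional.Properties using (deduplicate-!)
open import Function using (_∘_)
open import Relation.Binary using (StrictTotalOrder)
open import Relation.Binary.Definitions using (tri<; tri≈; tri>)
open import Relation.Binary.PropositionalEquality hiding ([_])
open import Relation.Nullary using (¬_; yes; no; Dec)
open import Relation.Nullary.Decidable using (decidable-stable; _⊎-dec_)
open import Relation.Unary using (Pred; Decidable)

module _ {a p q} {A : Set a} {P : Pred A p} {Q : Pred A q} (P? : Decidable P) (Q? : Decidable Q)
         (P⊆Q : ∀ {x} → P x → Q x) where

  count-mono : ∀ {m} (xs : Vec A m) → count P? xs ≤ count Q? xs
  count-mono [] = z≤n
  count-mono (x ∷ xs) with P? x | Q? x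
  ... | yes _  | yes _  = s≤s (count-mono xs)
  ... | yes Px | no ¬Qx = ⊥-elim (¬Qx (P⊆Q Px))
  ... | no _   | yes _  = m≤n⇒m≤1+n (count-mono xs)
  ... | no _   | no _   = count-mono xs

  count-strict : ∀ {m x} {xs : Vec A m} → x ∈ᵥ xs → Q x → ¬ P x → count P? xs < count Q? xs
  count-strict {xs = x ∷ xs} (here refl) Qx ¬Px with P? x | Q? x
  ... | yes Px | _      = ⊥-elim (¬Px Px)
  ... | no _   | yes _  = s≤s (count-mono xs)
  ... | no _   | no ¬Qx = ⊥-elim (¬Qx Qx)
  count-strict {xs = y ∷ xs} (there x∈xs) Qx ¬Px with P? y | Q? y
  ... | yes _  | yes _  = s≤s (count-strict x∈xs Qx ¬Px)
  ... | yes Py | no ¬Qy = ⊥-elim (¬Qy (P⊆Q Py))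
  ... | no _   | yes _  = m<n⇒m<1+n (count-strict x∈xs Qx ¬Px)
  ... | no _   | no _   = count-strict x∈xs Qx ¬Px

transpose : ℕ → ℕ → ℕ → ℕ
transpose i j k with k ≟ i | k ≟ j
... | yes _ | _     = j
... | no _  | yes _ = i
... | no _  | no _  = k

transpose-matchˡ : ∀ i j → transpose i j i ≡ j
transpose-matchˡ i j with i ≟ i
... | yes _  = refl
... | no i≢i = ⊥-elim (i≢i refl)

transpose-matchʳ : ∀ i j → transpose i j j ≡ i
transpose-matchʳ i j with j ≟ i | j ≟ j
... | yes j≡i | _      = j≡i
... | no _    | yes _  = refl
... | no _    | no j≢j = ⊥-elim (j≢j refl)

transpose-involutive : ∀ i j k → transpose i j (transpose i j k) ≡ k
transpose-involutive i j k with k ≟ i | k ≟ j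
... | yes refl | _        = transpose-matchʳ k j
... | no _     | yes refl = transpose-matchˡ i k
... | no k≢i   | no k≢j   with k ≟ i | k ≟ j
...   | yes k≡i | _       = ⊥-elim (k≢i k≡i)
...   | no _    | yes k≡j = ⊥-elim (k≢j k≡j)
...   | no _    | no _    = refl

transpose-injective : ∀ i j {k l} → transpose i j k ≡ transpose i j l → k ≡ l
transpose-injective i j {k} {l} eq = begin
  k                                 ≡⟨ sym (transpose-involutive i j k) ⟩
  transpose i j (transpose i j k)   ≡⟨ cong (transpose i j) eq ⟩
  transpose i j (transpose i j l)   ≡⟨ transpose-involutive i j l ⟩
  l                                 ∎
  where open ≡-Reasoning

transpose-preserves : ∀ {ℓ} (P : Pred ℕ ℓ) {i j k} → P i → P j → P k → P (transpose i j k)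
transpose-preserves P {i} {j} {k} Pi Pj Pk with k ≟ i | k ≟ j
... | yes _ | _     = Pj
... | no _  | yes _ = Pi
... | no _  | no _  = Pk

filter-length≡1 : ∀ {a p} {A : Set a} {P : Pred A p} (P? : Decidable P) xs →
                  length (filter P? xs) ≡ 1 → ∃[ x ] (x ∈ xs × P x × ∀ {y} → y ∈ xs → P y → y ≡ x)
filter-length≡1 P? xs len with filter P? xs in eq
filter-length≡1 P? xs refl | x ∷ [] =
  x , proj₁ x∈xs×Px , proj₂ x∈xs×Px , λ y∈xs Py → only (subst (_ ∈_) eq (∈-filter⁺ P? y∈xs Py))
  where
  x∈xs×Px = ∈-filter⁻ P? (subst (x ∈_) (sym eq) (here refl))
  only : ∀ {y} → y ∈ x ∷ [] → y ≡ x
  only (here y≡x) = y≡x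

Consec⇒index : ∀ {A : Set} {xs : List A} {x y} → Consec xs x y →
               Σ (x ∈ xs) λ p → Σ (y ∈ xs) λ q → toℕ (Any.index q) ≡ suc (toℕ (Any.index p))
Consec⇒index now = here refl , there (here refl) , refl
Consec⇒index (later c) with Consec⇒index c
... | p , q , q≡1+p = there p , there q , cong suc q≡1+p

intervals-apart-or-meet : ∀ {i₁ j₁ i₂ j₂} → i₁ ≤ j₁ → i₂ ≤ j₂ →
                          j₁ < i₂ ⊎ j₂ < i₁ ⊎ ∃[ k ] ((i₁ ≤ k × k ≤ j₁) × (i₂ ≤ k × k ≤ j₂))
intervals-apart-or-meet {i₁} {j₁} {i₂} {j₂} i₁≤j₁ i₂≤j₂ with j₁ <? i₂ | j₂ <? i₁
... | yes j₁<i₂ | _         = inj₁ j₁<i₂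
... | no _      | yes j₂<i₁ = inj₂ (inj₁ j₂<i₁)
... | no j₁≮i₂  | no j₂≮i₁  =
  inj₂ (inj₂ (i₁ ⊔ i₂ , (m≤m⊔n i₁ i₂ , ⊔-lub i₁≤j₁ (≮⇒≥ j₁≮i₂))
                     , (m≤n⊔m i₁ i₂ , ⊔-lub (≮⇒≥ j₂≮i₁) i₂≤j₂)))

endpoint-¬between : ∀ {p q x} → x ≡ p ⊎ x ≡ q → ¬ (p ⊓ q < x × x < p ⊔ q)
endpoint-¬between {p} {q} (inj₁ refl) (min<p , p<max) with ≤-total p q
... | inj₁ p≤q = <-irrefl (m≤n⇒m⊓n≡m p≤q) min<p
... | inj₂ q≤p = <-irrefl (sym (m≥n⇒m⊔n≡m q≤p)) p<max
endpoint-¬between {p} {q} (inj₂ refl) (min<q , q<max) =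
  endpoint-¬between {q} {p} (inj₁ refl) (subst (_< q) (⊓-comm p q) min<q , subst (q <_) (⊔-comm p q) q<max)

endpoint-¬outside : ∀ {p q x} → x ≡ p ⊎ x ≡ q → ¬ (x < p ⊓ q ⊎ p ⊔ q < x)
endpoint-¬outside {p} {q} (inj₁ refl) (inj₁ p<min) = <⇒≱ p<min (m⊓n≤m p q)
endpoint-¬outside {p} {q} (inj₁ refl) (inj₂ max<p) = <⇒≱ max<p (m≤m⊔n p q)
endpoint-¬outside {p} {q} (inj₂ refl) (inj₁ q<min) = <⇒≱ q<min (m⊓n≤n p q)
endpoint-¬outside {p} {q} (inj₂ refl) (inj₂ max<q) = <⇒≱ max<q (m≤n⊔m p q)

above-¬between : ∀ {p q x} → p < x → q < x → ¬ (p ⊓ q < x × x < p ⊔ q)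
above-¬between p<x q<x (_ , x<max) = <⇒≱ x<max (⊔-lub (<⇒≤ p<x) (<⇒≤ q<x))

below-¬between : ∀ {p q x} → x < p → x < q → ¬ (p ⊓ q < x × x < p ⊔ q)
below-¬between x<p x<q (min<x , _) = <⇒≱ min<x (⊓-glb (<⇒≤ x<p) (<⇒≤ x<q))

endpoint-trans : ∀ {n} {a b x : Fin n} {z} → toℕ a ≡ z ⊎ toℕ b ≡ z → toℕ x ≡ z →
                 toℕ x ≡ toℕ a ⊎ toℕ x ≡ toℕ b
endpoint-trans ab∋z x≡z = ⊎-map (λ a≡z → trans x≡z (sym a≡z)) (λ b≡z → trans x≡z (sym b≡z)) ab∋z

module _ {n : ℕ} {a b c d : Fin n} where

  ¬Cross-sharedEndpoint : ∀ {z} → toℕ a ≡ z ⊎ toℕ b ≡ z → toℕ c ≡ z ⊎ toℕ d ≡ z → ¬ Cross a b c d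
  ¬Cross-sharedEndpoint ab∋z (inj₁ c≡z) (inj₁ (c∈ab , _)) = endpoint-¬between (endpoint-trans ab∋z c≡z) c∈ab
  ¬Cross-sharedEndpoint ab∋z (inj₁ c≡z) (inj₂ (c∉ab , _)) = endpoint-¬outside (endpoint-trans ab∋z c≡z) c∉ab
  ¬Cross-sharedEndpoint ab∋z (inj₂ d≡z) (inj₁ (_ , d∉ab)) = endpoint-¬outside (endpoint-trans ab∋z d≡z) d∉ab
  ¬Cross-sharedEndpoint ab∋z (inj₂ d≡z) (inj₂ (_ , d∈ab)) = endpoint-¬between (endpoint-trans ab∋z d≡z) d∈ab

  ¬Cross-above : toℕ a < toℕ c → toℕ b < toℕ c → toℕ a < toℕ d → toℕ b < toℕ d → ¬ Cross a b c d
  ¬Cross-above a<c b<c _ _ (inj₁ (c-between , _)) = above-¬between a<c b<c c-between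
  ¬Cross-above _ _ a<d b<d (inj₂ (_ , d-between)) = above-¬between a<d b<d d-between

  ¬Cross-below : toℕ c < toℕ a → toℕ c < toℕ b → toℕ d < toℕ a → toℕ d < toℕ b → ¬ Cross a b c d
  ¬Cross-below c<a c<b _ _ (inj₁ (c-between , _)) = below-¬between c<a c<b c-between
  ¬Cross-below _ _ d<a d<b (inj₂ (_ , d-between)) = below-¬between d<a d<b d-between

  ¬Between-small : ∀ {x} → n ≤ 2 → ¬ Between a b x
  ¬Between-small {x} n≤2 (min<x , x<max) = ≤⇒≯ n≤2 (begin-strict
    2                 ≤⟨ s≤s (≤-trans (s≤s z≤n) min<x) ⟩
    suc (toℕ x)       ≤⟨ x<max ⟩
    toℕ a ⊔ toℕ b     <⟨ ⊔-lub (toℕ<n a) (toℕ<n b) ⟩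
    n                 ∎)
    where open ≤-Reasoning

  ¬Cross-small : n ≤ 2 → ¬ Cross a b c d
  ¬Cross-small n≤2 (inj₁ (c-between , _)) = ¬Between-small n≤2 c-between
  ¬Cross-small n≤2 (inj₂ (_ , d-between)) = ¬Between-small n≤2 d-between

avoid-two : ∀ {n} → 3 ≤ n → (u v : Fin n) → ∃[ w ] (w ≢ u × w ≢ v)
avoid-two (s≤s (s≤s (s≤s _))) u v with F.zero F.≟ u | F.zero F.≟ v
... | no 0≢u   | no 0≢v = F.zero , 0≢u , 0≢v
... | yes refl | _      = avoid-zero-and v
  where
  avoid-zero-and : ∀ {m} (v : Fin (3 + m)) → ∃[ w ] (w ≢ F.zero × w ≢ v)
  avoid-zero-and v with F.suc F.zero F.≟ v
  ... | no 1≢v   = F.suc F.zero , (λ ()) , 1≢v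
  ... | yes refl = F.suc (F.suc F.zero) , (λ ()) , (λ ())
... | no 0≢u   | yes refl with F.suc F.zero F.≟ u
...   | no 1≢u   = F.suc F.zero , 1≢u , (λ ())
...   | yes refl = F.suc (F.suc F.zero) , (λ ()) , (λ ())

module _ {n : ℕ} (G : Graph n) where

  Adj-sym : ∀ {u v} → Adj G u v → Adj G v u
  Adj-sym = swap

  leaf-neighbour : ∀ {v} → Leaf G v → ∃[ u ] (Adj G v u × ∀ {w} → Adj G v w → w ≡ u)
  leaf-neighbour {v} leaf with filter-length≡1 (λ e → (proj₁ e F.≟ v) ⊎-dec (proj₂ e F.≟ v)) (edges G) leaf
  ... | (_ , u) , vu∈G , inj₁ refl , only = u , inj₁ vu∈G , λ
    { (inj₁ vw∈G) → cong proj₂ (only vw∈G (inj₁ refl))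
    ; (inj₂ wv∈G) → let eq = only wv∈G (inj₂ refl) in trans (cong proj₁ eq) (cong proj₂ eq) }
  ... | (u , _) , uv∈G , inj₂ refl , only = u , inj₂ uv∈G , λ
    { (inj₁ vw∈G) → let eq = only vw∈G (inj₁ refl) in trans (cong proj₂ eq) (cong proj₁ eq)
    ; (inj₂ wv∈G) → cong proj₁ (only wv∈G (inj₂ refl)) }

  leaf-adj-unique : ∀ {v u w} → Leaf G v → Adj G v u → Adj G v w → w ≡ u
  leaf-adj-unique leaf vu vw = trans (only vw) (sym (only vu))
    where only = proj₂ (proj₂ (leaf-neighbour leaf))

  Walk-closed : ∀ {ℓ} (P : Pred (Fin n) ℓ) → (∀ {x y} → P x → Adj G x y → P y) →
                ∀ {x y} → Walk G x y → P x → P y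
  Walk-closed P closed here         Px = Px
  Walk-closed P closed (step xw wy) Px = Walk-closed P closed wy (closed Px xw)

  leaves-nonadjacent : Connected G → 3 ≤ n → ∀ {u v} → Leaf G u → Leaf G v → ¬ Adj G u v
  leaves-nonadjacent connected 3≤n {u} {v} leaf-u leaf-v uv with avoid-two 3≤n u v
  ... | w , w≢u , w≢v = [ w≢u , w≢v ] (Walk-closed Pair closed (connected u w) (inj₁ refl))
    where
    Pair : Pred (Fin n) _
    Pair x = x ≡ u ⊎ x ≡ v
    closed : ∀ {x y} → Pair x → Adj G x y → Pair y
    closed (inj₁ refl) xy = inj₂ (leaf-adj-unique leaf-u uv xy)
    closed (inj₂ refl) xy = inj₁ (leaf-adj-unique leaf-v (Adj-sym uv) xy)

record IntervalHubs {n : ℕ} (G : Graph n) : Set where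
  field
    hub         : ℕ → ℕ → ℕ
    hub-within  : ∀ {a b} → a < b → a ≤ hub a b × hub a b < b
    hub-adj     : ∀ {a b} {x y : Fin n} → b ≤ n → toℕ x ≡ hub a b →
                  a ≤ toℕ y → toℕ y < b → x ≢ y → Adj G x y
    hub-adj-hub : ∀ {a b d} {x y : Fin n} → a < b → b < d → d ≤ n →
                  toℕ x ≡ hub a b → toℕ y ≡ hub b d → Adj G x y

  hub-singleton : ∀ a → hub a (suc a) ≡ a
  hub-singleton a = ≤-antisym (s≤s⁻¹ (proj₂ within)) (proj₁ within)
    where within = hub-within (n<1+n a)

  consecutive-adjacent : ∀ {x y : Fin n} → toℕ y ≡ suc (toℕ x) → Adj G x y
  consecutive-adjacent {x} {y} y≡1+x =
    hub-adj-hub (≤-reflexive (sym y≡1+x)) (n<1+n (toℕ y)) (toℕ<n y)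
      (sym (trans (cong (hub (toℕ x)) y≡1+x) (hub-singleton (toℕ x))))
      (sym (hub-singleton (toℕ y)))

  small-embedding : (H : Graph n) → n ≤ 2 → Embeds H G
  small-embedding H n≤2 = (λ v → v) , (λ eq → eq) , adjacent , λ _ _ → ¬Cross-small n≤2
    where
    adjacent : ∀ {a b} → (a , b) ∈ edges H → Adj G a b
    adjacent {a} {b} ab∈H = consecutive-adjacent (≤-antisym b≤1+a a<b)
      where
      a<b : toℕ a < toℕ b
      a<b = All.lookup (ordered H) ab∈H
      b≤1+a : toℕ b ≤ suc (toℕ a)
      b≤1+a = ≤-trans (s≤s⁻¹ (≤-trans (toℕ<n b) n≤2)) (s≤s z≤n)

open StrictTotalOrder (×-strictTotalOrder <-strictTotalOrder <-strictTotalOrder)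
  using ()
  renaming (_<_ to _<ₗₑₓ_; _<?_ to _<ₗₑₓ?_; compare to compareₗₑₓ; trans to <ₗₑₓ-trans; irrefl to <ₗₑₓ-irrefl)

module Spine {n} {H : Graph n} (3≤n : 3 ≤ n) (connected : Connected H)
  {L : List (Fin n)} (L-unique : Unique L) (nonleaf∈L : ∀ v → ¬ Leaf H v → v ∈ L)
  (adj⇒consec : ∀ u v → u ∈ L → v ∈ L → Adj H u v → Consec L u v ⊎ Consec L v u) where

  open import Data.List.Membership.DecPropositional (F._≟_ {n}) using (_∈?_)

  ∉L⇒leaf : ∀ {v} → v ∉ L → Leaf H v
  ∉L⇒leaf {v} v∉L = decidable-stable (degree H v ≟ 1) (λ ¬leaf → v∉L (nonleaf∈L v ¬leaf))

  neighbour∈L : ∀ {v u} → v ∉ L → Adj H v u → u ∈ L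
  neighbour∈L {v} {u} v∉L vu =
    decidable-stable (u ∈? L) (λ u∉L → leaves-nonadjacent H connected 3≤n (∉L⇒leaf v∉L) (∉L⇒leaf u∉L) vu)

  spine : Fin n → Fin n
  spine v with v ∈? L
  ... | yes _   = v
  ... | no v∉L = proj₁ (leaf-neighbour H (∉L⇒leaf v∉L))

  spine∈L : ∀ v → spine v ∈ L
  spine∈L v with v ∈? L
  ... | yes v∈L = v∈L
  ... | no v∉L  = neighbour∈L v∉L (proj₁ (proj₂ (leaf-neighbour H (∉L⇒leaf v∉L))))

  spine-∈L : ∀ {v} → v ∈ L → spine v ≡ v
  spine-∈L {v} v∈L with v ∈? L
  ... | yes _   = refl
  ... | no v∉L = ⊥-elim (v∉L v∈L)

  spine-∉L : ∀ {v w} → v ∉ L → Adj H v w → spine v ≡ w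
  spine-∉L {v} v∉L vw with v ∈? L
  ... | yes v∈L = ⊥-elim (v∉L v∈L)
  ... | no v∉L′ = sym (proj₂ (proj₂ (leaf-neighbour H (∉L⇒leaf v∉L′))) vw)

  spineIndex : ∀ {v} → v ∈ L → ℕ
  spineIndex v∈L = toℕ (Any.index v∈L)

  spineIndex-cong : ∀ {u v} → u ≡ v → (p : u ∈ L) (q : v ∈ L) → spineIndex p ≡ spineIndex q
  spineIndex-cong refl p q = cong spineIndex (unique⇒irrelevant L-unique p q)

  spineIndex-injective : ∀ {u v} (p : u ∈ L) (q : v ∈ L) → spineIndex p ≡ spineIndex q → u ≡ v
  spineIndex-injective p q eq = index-injective (setoid (Fin n)) p q (toℕ-injective eq)

  block : Fin n → ℕ
  block v = spineIndex (spine∈L v)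

  block-∈L : ∀ {v} (v∈L : v ∈ L) → block v ≡ spineIndex v∈L
  block-∈L v∈L = spineIndex-cong (spine-∈L v∈L) (spine∈L _) v∈L

  block-spine : ∀ v → block (spine v) ≡ block v
  block-spine v = block-∈L (spine∈L v)

  block-injective : ∀ {u v} → block u ≡ block v → spine u ≡ spine v
  block-injective {u} {v} = spineIndex-injective (spine∈L u) (spine∈L v)

  block-Consec : ∀ {u v} → u ∈ L → v ∈ L → Consec L u v → block v ≡ suc (block u)
  block-Consec {u} {v} u∈L v∈L c with Consec⇒index c
  ... | p , q , q≡1+p = begin
    block v               ≡⟨ block-∈L v∈L ⟩
    spineIndex v∈L        ≡⟨ spineIndex-cong refl v∈L q ⟩
    spineIndex q          ≡⟨ q≡1+p ⟩
    suc (spineIndex p)    ≡⟨ cong suc (spineIndex-cong refl p u∈L) ⟩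
    suc (spineIndex u∈L)  ≡⟨ cong suc (block-∈L u∈L) ⟨
    suc (block u)         ∎
    where open ≡-Reasoning

  block-leaf : ∀ {u v} → v ∉ L → u ∈ L → Adj H v u → block v ≡ block u
  block-leaf {u} {v} v∉L u∈L vu = trans (spineIndex-cong (spine-∉L v∉L vu) (spine∈L v) u∈L) (sym (block-∈L u∈L))

  data EdgeShape (a b : Fin n) : Set where
    spine-edge : a ∈ L → b ∈ L → block b ≡ suc (block a) → EdgeShape a b
    leaf-edge  : a ∈ L → b ∉ L → block b ≡ block a → EdgeShape a b

  edgeShape : ∀ {a b} → Adj H a b → EdgeShape a b ⊎ EdgeShape b a
  edgeShape {a} {b} ab with a ∈? L | b ∈? L
  ... | yes a∈L | yes b∈L =
    ⊎-map (spine-edge a∈L b∈L ∘ block-Consec a∈L b∈L) (spine-edge b∈L a∈L ∘ block-Consec b∈L a∈L)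
          (adj⇒consec a b a∈L b∈L ab)
  ... | yes a∈L | no b∉L  = inj₁ (leaf-edge a∈L b∉L (block-leaf b∉L a∈L (Adj-sym H ab)))
  ... | no a∉L  | yes b∈L = inj₂ (leaf-edge b∈L a∉L (block-leaf a∉L b∈L ab))
  ... | no a∉L  | no b∉L  = ⊥-elim (b∉L (neighbour∈L a∉L ab))

  module Layout {G : Graph n} (hubs : IntervalHubs G) where

    open IntervalHubs hubs

    blockStart : ℕ → ℕ
    blockStart i = count (λ w → block w <? i) (allFin n)

    InBlock : ℕ → ℕ → Set
    InBlock i x = blockStart i ≤ x × x < blockStart (suc i)

    blockStart-mono : ∀ {i j} → i ≤ j → blockStart i ≤ blockStart j
    blockStart-mono {i} {j} i≤j =
      count-mono (λ w → block w <? i) (λ w → block w <? j) (λ lt → <-≤-trans lt i≤j) (allFin n)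

    blockStart≤n : ∀ {i} → blockStart i ≤ n
    blockStart≤n {i} = count≤n (λ w → block w <? i) (allFin n)

    _≺_ : Fin n → Fin n → Set
    u ≺ v = (block u , toℕ u) <ₗₑₓ (block v , toℕ v)

    _≺?_ : ∀ u v → Dec (u ≺ v)
    u ≺? v = (block u , toℕ u) <ₗₑₓ? (block v , toℕ v)

    rank : Fin n → ℕ
    rank v = count (_≺? v) (allFin n)

    rank-mono : ∀ {u v} → u ≺ v → rank u < rank v
    rank-mono {u} {v} u≺v =
      count-strict (_≺? u) (_≺? v) (λ w≺u → <ₗₑₓ-trans w≺u u≺v) (∈-allFin⁺ u) u≺v (<ₗₑₓ-irrefl (refl , refl))

    rank-injective : ∀ {u v} → rank u ≡ rank v → u ≡ v
    rank-injective {u} {v} eq with compareₗₑₓ (block u , toℕ u) (block v , toℕ v)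
    ... | tri< u≺v _ _       = ⊥-elim (<⇒≢ (rank-mono u≺v) eq)
    ... | tri≈ _ (_ , u≡v) _ = toℕ-injective u≡v
    ... | tri> _ _ v≺u       = ⊥-elim (<⇒≢ (rank-mono v≺u) (sym eq))

    rank-inBlock : ∀ v → InBlock (block v) (rank v)
    rank-inBlock v =
      count-mono (λ w → block w <? block v) (_≺? v) inj₁ (allFin n) ,
      count-strict (_≺? v) (λ w → block w <? suc (block v)) ≺⇒<suc
                   (∈-allFin⁺ v) (n<1+n (block v)) (<ₗₑₓ-irrefl (refl , refl))
      where
      ≺⇒<suc : ∀ {w} → w ≺ v → block w < suc (block v)
      ≺⇒<suc (inj₁ lt)       = m<n⇒m<1+n lt
      ≺⇒<suc (inj₂ (eq , _)) = s≤s (≤-reflexive eq)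

    block-nonempty : ∀ v → blockStart (block v) < blockStart (suc (block v))
    block-nonempty v = ≤-<-trans (proj₁ (rank-inBlock v)) (proj₂ (rank-inBlock v))

    blockHub : ℕ → ℕ
    blockHub i = hub (blockStart i) (blockStart (suc i))

    -- Ranking by (block, label) lays the blocks out consecutively; swapping the rank of the
    -- block's spine vertex with the block's hub then moves that vertex onto the hub.
    pos : Fin n → ℕ
    pos v = transpose (rank (spine v)) (blockHub (block v)) (rank v)

    pos-inBlock : ∀ v → InBlock (block v) (pos v)
    pos-inBlock v = transpose-preserves (InBlock (block v))
      (subst (λ i → InBlock i (rank (spine v))) (block-spine v) (rank-inBlock (spine v)))
      (hub-within (block-nonempty v))
      (rank-inBlock v)

    pos-<-block : ∀ {u v} → block u < block v → pos u < pos v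
    pos-<-block {u} {v} lt = begin-strict
      pos u                       <⟨ proj₂ (pos-inBlock u) ⟩
      blockStart (suc (block u))  ≤⟨ blockStart-mono lt ⟩
      blockStart (block v)        ≤⟨ proj₁ (pos-inBlock v) ⟩
      pos v                       ∎
      where open ≤-Reasoning

    pos-injective : ∀ {u v} → pos u ≡ pos v → u ≡ v
    pos-injective {u} {v} eq = rank-injective (transpose-injective (rank (spine v)) (blockHub (block v)) (begin
      transpose (rank (spine v)) (blockHub (block v)) (rank u)
        ≡⟨ cong₂ (λ s i → transpose (rank s) (blockHub i) (rank u)) (block-injective same-block) same-block ⟨
      pos u ≡⟨ eq ⟩
      pos v ∎))
      where
      open ≡-Reasoning
      same-block : block u ≡ block v
      same-block with <-cmp (block u) (block v)
      ... | tri< lt _ _ = ⊥-elim (<⇒≢ (pos-<-block lt) eq)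
      ... | tri≈ _ b≡ _ = b≡
      ... | tri> _ _ gt = ⊥-elim (<⇒≢ (pos-<-block gt) (sym eq))

    pos-∈L : ∀ {v} → v ∈ L → pos v ≡ blockHub (block v)
    pos-∈L {v} v∈L = trans (cong (λ s → transpose (rank s) (blockHub (block v)) (rank v)) (spine-∈L v∈L))
                           (transpose-matchˡ (rank v) (blockHub (block v)))

    opaque
      φ : Fin n → Fin n
      φ v = fromℕ< (<-≤-trans (proj₂ (pos-inBlock v)) blockStart≤n)

      toℕ-φ : ∀ v → toℕ (φ v) ≡ pos v
      toℕ-φ v = toℕ-fromℕ< _

    φ-injective : ∀ {u v} → φ u ≡ φ v → u ≡ v
    φ-injective {u} {v} eq = pos-injective (trans (sym (toℕ-φ u)) (trans (cong toℕ eq) (toℕ-φ v)))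

    φ-inBlock : ∀ v → InBlock (block v) (toℕ (φ v))
    φ-inBlock v = subst (InBlock (block v)) (sym (toℕ-φ v)) (pos-inBlock v)

    φ-<-block : ∀ {u v} → block u < block v → toℕ (φ u) < toℕ (φ v)
    φ-<-block {u} {v} lt = subst₂ _<_ (sym (toℕ-φ u)) (sym (toℕ-φ v)) (pos-<-block lt)

    φ-∈L : ∀ {v} → v ∈ L → toℕ (φ v) ≡ blockHub (block v)
    φ-∈L {v} v∈L = trans (toℕ-φ v) (pos-∈L v∈L)

    record Span (a b : Fin n) : Set where
      field
        first last : ℕ
        a-spanned  : first ≤ block a × block a ≤ last
        b-spanned  : first ≤ block b × block b ≤ last
        hub-ends   : ∀ {k} → first ≤ k → k ≤ last → toℕ (φ a) ≡ blockHub k ⊎ toℕ (φ b) ≡ blockHub k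

      first≤last : first ≤ last
      first≤last = ≤-trans (proj₁ a-spanned) (proj₂ a-spanned)

    Span-sym : ∀ {a b} → Span a b → Span b a
    Span-sym s = record
      { first = first ; last = last ; a-spanned = b-spanned ; b-spanned = a-spanned
      ; hub-ends = λ first≤k k≤last → swap (hub-ends first≤k k≤last) }
      where open Span s

    φ-<-spanned : ∀ {i₁ j₁ i₂ j₂ u v} → j₁ < i₂ → i₁ ≤ block u × block u ≤ j₁ → i₂ ≤ block v × block v ≤ j₂ →
                  toℕ (φ u) < toℕ (φ v)
    φ-<-spanned j₁<i₂ (_ , u≤j₁) (i₂≤v , _) = φ-<-block (≤-<-trans u≤j₁ (<-≤-trans j₁<i₂ i₂≤v))

    Span-¬Cross : ∀ {a b c d} → Span a b → Span c d → ¬ Cross (φ a) (φ b) (φ c) (φ d)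
    Span-¬Cross {a} {b} {c} {d} s t = separate-or-meet (intervals-apart-or-meet (first≤last s) (first≤last t))
      where
      open Span
      separate-or-meet : last s < first t ⊎ last t < first s ⊎
                         ∃[ k ] ((first s ≤ k × k ≤ last s) × (first t ≤ k × k ≤ last t)) →
                         ¬ Cross (φ a) (φ b) (φ c) (φ d)
      separate-or-meet (inj₁ s<t) =
        ¬Cross-above (φ-<-spanned s<t (a-spanned s) (a-spanned t)) (φ-<-spanned s<t (b-spanned s) (a-spanned t))
                     (φ-<-spanned s<t (a-spanned s) (b-spanned t)) (φ-<-spanned s<t (b-spanned s) (b-spanned t))
      separate-or-meet (inj₂ (inj₁ t<s)) =
        ¬Cross-below (φ-<-spanned t<s (a-spanned t) (a-spanned s)) (φ-<-spanned t<s (a-spanned t) (b-spanned s))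
                     (φ-<-spanned t<s (b-spanned t) (a-spanned s)) (φ-<-spanned t<s (b-spanned t) (b-spanned s))
      separate-or-meet (inj₂ (inj₂ (k , (s≤k , k≤s) , (t≤k , k≤t)))) =
        ¬Cross-sharedEndpoint (hub-ends s s≤k k≤s) (hub-ends t t≤k k≤t)

    Placed : Fin n → Fin n → Set
    Placed a b = Adj G (φ a) (φ b) × Span a b

    Placed-sym : ∀ {a b} → Placed a b → Placed b a
    Placed-sym (ab , s) = Adj-sym G ab , Span-sym s

    spine-edge-placed : ∀ {a b} → a ∈ L → b ∈ L → block b ≡ suc (block a) → Placed a b
    spine-edge-placed {a} {b} a∈L b∈L b≡1+a = adj , span
      where
      i = block a
      adj : Adj G (φ a) (φ b)
      adj = hub-adj-hub (block-nonempty a) (subst (λ j → blockStart j < blockStart (suc j)) b≡1+a (block-nonempty b))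
              blockStart≤n (φ-∈L a∈L) (trans (φ-∈L b∈L) (cong blockHub b≡1+a))
      ends : ∀ {k} → i ≤ k → k ≤ suc i → toℕ (φ a) ≡ blockHub k ⊎ toℕ (φ b) ≡ blockHub k
      ends i≤k k≤1+i with m≤n⇒m<n∨m≡n k≤1+i
      ... | inj₁ k<1+i = inj₁ (trans (φ-∈L a∈L) (cong blockHub (≤-antisym i≤k (s≤s⁻¹ k<1+i))))
      ... | inj₂ refl  = inj₂ (trans (φ-∈L b∈L) (cong blockHub b≡1+a))
      span : Span a b
      span = record
        { first = i ; last = suc i ; a-spanned = ≤-refl , n≤1+n i
        ; b-spanned = ≤-trans (n≤1+n i) (≤-reflexive (sym b≡1+a)) , ≤-reflexive b≡1+a ; hub-ends = ends }

    leaf-edge-placed : ∀ {a b} → a ∈ L → b ∉ L → block b ≡ block a → Placed a b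
    leaf-edge-placed {a} {b} a∈L b∉L b≡a = adj , span
      where
      i = block a
      b-inBlock : InBlock i (toℕ (φ b))
      b-inBlock = subst (λ j → InBlock j (toℕ (φ b))) b≡a (φ-inBlock b)
      adj : Adj G (φ a) (φ b)
      adj = hub-adj blockStart≤n (φ-∈L a∈L) (proj₁ b-inBlock) (proj₂ b-inBlock)
              (λ φa≡φb → b∉L (subst (_∈ L) (φ-injective φa≡φb) a∈L))
      span : Span a b
      span = record
        { first = i ; last = i ; a-spanned = ≤-refl , ≤-refl
        ; b-spanned = ≤-reflexive (sym b≡a) , ≤-reflexive b≡a
        ; hub-ends = λ i≤k k≤i → inj₁ (trans (φ-∈L a∈L) (cong blockHub (≤-antisym i≤k k≤i))) }

    shape-placed : ∀ {a b} → EdgeShape a b → Placed a b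
    shape-placed (spine-edge a∈L b∈L b≡1+a) = spine-edge-placed a∈L b∈L b≡1+a
    shape-placed (leaf-edge a∈L b∉L b≡a)    = leaf-edge-placed a∈L b∉L b≡a

    embedding : Embeds H G
    embedding = φ , φ-injective , (λ ab∈H → proj₁ (edge-placed ab∈H)) ,
                λ ab∈H cd∈H → Span-¬Cross (proj₂ (edge-placed ab∈H)) (proj₂ (edge-placed cd∈H))
      where
      edge-placed : ∀ {a b} → (a , b) ∈ edges H → Placed a b
      edge-placed ab∈H with edgeShape (inj₁ ab∈H)
      ... | inj₁ shape = shape-placed shape
      ... | inj₂ shape = Placed-sym (shape-placed shape)

-- The spine of a caterpillar on at most two vertices may be empty, so those are embedded by the
-- identity instead.
caterpillar-universal : ∀ {n} {G : Graph n} → IntervalHubs G → UniversalForCaterpillars G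
caterpillar-universal {n} hubs H ((connected , _) , L , L-unique , _ , nonleaf∈L , adj⇔consec) with 3 ≤? n
... | yes 3≤n = Spine.Layout.embedding 3≤n connected L-unique nonleaf∈L adj⇒consec hubs
  where adj⇒consec = λ u v u∈L v∈L → proj₁ (adj⇔consec u v u∈L v∈L)
... | no 3≰n  = IntervalHubs.small-embedding hubs H (s≤s⁻¹ (≰⇒> 3≰n))

Linked : List (ℕ × ℕ) → ℕ → ℕ → Set
Linked E x y = (x , y) ∈ E × x < y

Adjacent : List (ℕ × ℕ) → ℕ → ℕ → Set
Adjacent E x y = Linked E x y ⊎ Linked E y x

Adjacent-sym : ∀ {E x y} → Adjacent E x y → Adjacent E y x
Adjacent-sym = swap

Adjacent-mono : ∀ {E E′ x y} → E ⊆ E′ → Adjacent E x y → Adjacent E′ x y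
Adjacent-mono E⊆E′ = ⊎-map (map₁ E⊆E′) (map₁ E⊆E′)

finPairs : (n : ℕ) → List (ℕ × ℕ) → List (Fin n × Fin n)
finPairs n [] = []
finPairs n ((x , y) ∷ ps) with x <? y | y <? n
... | yes x<y | yes y<n = (fromℕ< (<-trans x<y y<n) , fromℕ< y<n) ∷ finPairs n ps
... | yes _   | no _    = finPairs n ps
... | no _    | _       = finPairs n ps

length-finPairs : ∀ n ps → length (finPairs n ps) ≤ length ps
length-finPairs n [] = z≤n
length-finPairs n ((x , y) ∷ ps) with x <? y | y <? n
... | yes _ | yes _ = s≤s (length-finPairs n ps)
... | yes _ | no _  = m≤n⇒m≤1+n (length-finPairs n ps)
... | no _  | _     = m≤n⇒m≤1+n (length-finPairs n ps)

finPairs-ordered : ∀ n ps → All (λ e → proj₁ e F.< proj₂ e) (finPairs n ps)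
finPairs-ordered n [] = []
finPairs-ordered n ((x , y) ∷ ps) with x <? y | y <? n
... | yes x<y | yes y<n = subst₂ _<_ (sym (toℕ-fromℕ< _)) (sym (toℕ-fromℕ< y<n)) x<y ∷ finPairs-ordered n ps
... | yes _   | no _    = finPairs-ordered n ps
... | no _    | _       = finPairs-ordered n ps

∈-finPairs : ∀ {n ps} {a b : Fin n} → Linked ps (toℕ a) (toℕ b) → (a , b) ∈ finPairs n ps
∈-finPairs {n} {(x , y) ∷ ps} {a} {b} (here refl , a<b) with toℕ a <? toℕ b | toℕ b <? n
... | yes _ | yes _  = here (cong₂ _,_ (sym (fromℕ<-toℕ a _)) (sym (fromℕ<-toℕ b _)))
... | yes _ | no b≮n = ⊥-elim (b≮n (toℕ<n b))
... | no a≮b | _     = ⊥-elim (a≮b a<b)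
∈-finPairs {n} {(x , y) ∷ ps} (there ab∈ps , a<b) with x <? y | y <? n
... | yes _ | yes _ = there (∈-finPairs (ab∈ps , a<b))
... | yes _ | no _  = ∈-finPairs (ab∈ps , a<b)
... | no _  | _     = ∈-finPairs (ab∈ps , a<b)

_≟ₑ_ : ∀ {n} (e f : Fin n × Fin n) → Dec (e ≡ f)
_≟ₑ_ = ≡-dec F._≟_ F._≟_

pairsGraph : (n : ℕ) → List (ℕ × ℕ) → Graph n
pairsGraph n ps = record
  { edges   = deduplicate _≟ₑ_ (finPairs n ps)
  ; ordered = deduplicate⁺ _≟ₑ_ (finPairs-ordered n ps)
  ; unique  = deduplicate-! _≟ₑ_ (finPairs n ps)
  }

numEdges-pairsGraph : ∀ n ps → numEdges (pairsGraph n ps) ≤ length ps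
numEdges-pairsGraph n ps = ≤-trans (length-deduplicate _≟ₑ_ (finPairs n ps)) (length-finPairs n ps)

Adjacent⇒Adj : ∀ {n ps} {a b : Fin n} → Adjacent ps (toℕ a) (toℕ b) → Adj (pairsGraph n ps) a b
Adjacent⇒Adj = ⊎-map (∈-deduplicate⁺ _≟ₑ_ ∘ ∈-finPairs) (∈-deduplicate⁺ _≟ₑ_ ∘ ∈-finPairs)

range : ℕ → ℕ → List ℕ
range lo k = applyUpTo (lo +_) k

∈-range : ∀ {lo k x} → lo ≤ x → x < lo + k → x ∈ range lo k
∈-range {lo} {k} {x} lo≤x x<lo+k =
  subst (_∈ range lo k) (m+[n∸m]≡n lo≤x)
    (∈-applyUpTo⁺ (lo +_) (+-cancelˡ-< lo (x ∸ lo) k (subst (_< lo + k) (sym (m+[n∸m]≡n lo≤x)) x<lo+k)))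

mid : ℕ → ℕ → ℕ
mid lo l = lo + ⌊ l /2⌋

mid<end : ∀ lo l → mid lo l < lo + suc l
mid<end lo l = +-monoʳ-< lo (s≤s (⌊n/2⌋≤n l))

right-end : ∀ lo l → suc (mid lo l) + ⌈ l /2⌉ ≡ lo + suc l
right-end lo l = begin
  suc (lo + ⌊ l /2⌋ + ⌈ l /2⌉)   ≡⟨ cong suc (+-assoc lo ⌊ l /2⌋ ⌈ l /2⌉) ⟩
  suc (lo + (⌊ l /2⌋ + ⌈ l /2⌉)) ≡⟨ cong (λ k → suc (lo + k)) (⌊n/2⌋+⌈n/2⌉≡n l) ⟩
  suc (lo + l)                   ≡⟨ sym (+-suc lo l) ⟩
  lo + suc l                     ∎
  where open ≡-Reasoning

spokesBelow spokesAbove spokes : ℕ → ℕ → List (ℕ × ℕ)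
spokesBelow lo l = map (_, mid lo l) (range lo ⌊ l /2⌋)
spokesAbove lo l = map (mid lo l ,_) (range (suc (mid lo l)) ⌈ l /2⌉)
spokes lo l = spokesBelow lo l ++ spokesAbove lo l

-- The graph on [lo, lo + len); the fuel, any value ≥ len, only makes the halving recursion
-- structural.
starEdges : (fuel lo len : ℕ) → List (ℕ × ℕ)
starEdges zero    lo len     = []
starEdges (suc f) lo zero    = []
starEdges (suc f) lo (suc l) = spokes lo l ++ (starEdges f lo ⌊ l /2⌋ ++ starEdges f (suc (mid lo l)) ⌈ l /2⌉)

module _ (f lo l : ℕ) where

  private
    left right : List (ℕ × ℕ)
    left  = starEdges f lo ⌊ l /2⌋
    right = starEdges f (suc (mid lo l)) ⌈ l /2⌉

  ⊆-left : left ⊆ starEdges (suc f) lo (suc l)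
  ⊆-left = xs⊆ys++xs (left ++ right) (spokes lo l) ∘ xs⊆xs++ys left right

  ⊆-right : right ⊆ starEdges (suc f) lo (suc l)
  ⊆-right = xs⊆ys++xs (left ++ right) (spokes lo l) ∘ xs⊆ys++xs right left

  spoke-adjacent : ∀ {x} → lo ≤ x → x < lo + suc l → x ≢ mid lo l →
                   Adjacent (starEdges (suc f) lo (suc l)) (mid lo l) x
  spoke-adjacent {x} lo≤x x<end x≢m with <-cmp x (mid lo l)
  ... | tri< x<m _ _ = inj₂ (⊆-spokes (xs⊆xs++ys (spokesBelow lo l) (spokesAbove lo l) (∈-map⁺ (_, mid lo l) (∈-range lo≤x x<m))) , x<m)
    where ⊆-spokes = xs⊆xs++ys (spokes lo l) (left ++ right)
  ... | tri≈ _ x≡m _ = ⊥-elim (x≢m x≡m)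
  ... | tri> _ _ m<x = inj₁ (⊆-spokes (xs⊆ys++xs (spokesAbove lo l) (spokesBelow lo l) (∈-map⁺ (mid lo l ,_) (∈-range m<x x<end′))) , m<x)
    where ⊆-spokes = xs⊆xs++ys (spokes lo l) (left ++ right)
          x<end′ = subst (x <_) (sym (right-end lo l)) x<end

data Position (m a b : ℕ) : Set where
  before : b ≤ m → Position m a b
  after  : m < a → Position m a b
  around : a ≤ m → m < b → Position m a b

position : ∀ m a b → Position m a b
position m a b with b ≤? m | m <? a
... | yes b≤m | _       = before b≤m
... | no _    | yes m<a = after m<a
... | no b≰m  | no m≮a  = around (≮⇒≥ m≮a) (≰⇒> b≰m)

starHub : (fuel lo len a b : ℕ) → ℕ
starHub zero    lo len     a b = a
starHub (suc f) lo zero    a b = a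
starHub (suc f) lo (suc l) a b with position (mid lo l) a b
... | before _   = starHub f lo ⌊ l /2⌋ a b
... | after _    = starHub f (suc (mid lo l)) ⌈ l /2⌉ a b
... | around _ _ = mid lo l

starHub-within : ∀ f lo len {a b} → a < b → a ≤ starHub f lo len a b × starHub f lo len a b < b
starHub-within zero    lo len     a<b = ≤-refl , a<b
starHub-within (suc f) lo zero    a<b = ≤-refl , a<b
starHub-within (suc f) lo (suc l) {a} {b} a<b with position (mid lo l) a b
... | before _       = starHub-within f lo ⌊ l /2⌋ a<b
... | after _        = starHub-within f (suc (mid lo l)) ⌈ l /2⌉ a<b
... | around a≤m m<b = a≤m , m<b

empty-interval : ∀ {lo x} → lo ≤ x → x < lo + 0 → ⊥
empty-interval {lo} lo≤x x<lo = <⇒≱ (subst (_ <_) (+-identityʳ lo) x<lo) lo≤x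

starHub-adj : ∀ f lo len {a b x} → len ≤ f → lo ≤ a → a ≤ x → x < b → b ≤ lo + len →
              x ≢ starHub f lo len a b → Adjacent (starEdges f lo len) (starHub f lo len a b) x
starHub-adj zero    lo zero    _ lo≤a a≤x x<b b≤end _ =
  ⊥-elim (empty-interval (≤-trans lo≤a a≤x) (<-≤-trans x<b b≤end))
starHub-adj (suc f) lo zero    _ lo≤a a≤x x<b b≤end _ =
  ⊥-elim (empty-interval (≤-trans lo≤a a≤x) (<-≤-trans x<b b≤end))
starHub-adj (suc f) lo (suc l) {a} {b} (s≤s l≤f) lo≤a a≤x x<b b≤end x≢hub with position (mid lo l) a b
... | before b≤m =
  Adjacent-mono (⊆-left f lo l) (starHub-adj f lo ⌊ l /2⌋ (≤-trans (⌊n/2⌋≤n l) l≤f) lo≤a a≤x x<b b≤m x≢hub)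
... | after m<a =
  Adjacent-mono (⊆-right f lo l) (starHub-adj f (suc (mid lo l)) ⌈ l /2⌉ (≤-trans (⌈n/2⌉≤n l) l≤f) m<a a≤x x<b
    (subst (b ≤_) (sym (right-end lo l)) b≤end) x≢hub)
... | around _ _ = spoke-adjacent f lo l (≤-trans lo≤a a≤x) (<-≤-trans x<b b≤end) x≢hub

starHub-adj-hub : ∀ f lo len {a b d} → len ≤ f → lo ≤ a → a < b → b < d → d ≤ lo + len →
                  Adjacent (starEdges f lo len) (starHub f lo len a b) (starHub f lo len b d)
starHub-adj-hub zero    lo zero    _ lo≤a a<b b<d d≤end =
  ⊥-elim (empty-interval lo≤a (<-≤-trans (<-trans a<b b<d) d≤end))
starHub-adj-hub (suc f) lo zero    _ lo≤a a<b b<d d≤end =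
  ⊥-elim (empty-interval lo≤a (<-≤-trans (<-trans a<b b<d) d≤end))
starHub-adj-hub (suc f) lo (suc l) {a} {b} {d} (s≤s l≤f) lo≤a a<b b<d d≤end
  with position (mid lo l) a b | position (mid lo l) b d
... | before _   | before d≤m =
  Adjacent-mono (⊆-left f lo l) (starHub-adj-hub f lo ⌊ l /2⌋ (≤-trans (⌊n/2⌋≤n l) l≤f) lo≤a a<b b<d d≤m)
... | after m<a  | after _    =
  Adjacent-mono (⊆-right f lo l) (starHub-adj-hub f (suc (mid lo l)) ⌈ l /2⌉ (≤-trans (⌈n/2⌉≤n l) l≤f) m<a a<b b<d
    (subst (d ≤_) (sym (right-end lo l)) d≤end))
... | before b≤m | around _ _ =
  Adjacent-sym (spoke-adjacent f lo l (≤-trans lo≤a a≤h) (<-trans h<m (mid<end lo l)) (<⇒≢ h<m))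
  where
  a≤h = proj₁ (starHub-within f lo ⌊ l /2⌋ a<b)
  h<m = <-≤-trans (proj₂ (starHub-within f lo ⌊ l /2⌋ a<b)) b≤m
... | around _ m<b | after _  =
  spoke-adjacent f lo l (≤-trans lo≤a (≤-trans (<⇒≤ a<b) b≤h)) (<-≤-trans h<d d≤end) (≢-sym (<⇒≢ m<h))
  where
  b≤h = proj₁ (starHub-within f (suc (mid lo l)) ⌈ l /2⌉ b<d)
  h<d = proj₂ (starHub-within f (suc (mid lo l)) ⌈ l /2⌉ b<d)
  m<h = <-≤-trans m<b b≤h
... | before b≤m   | after m<b    = ⊥-elim (<⇒≱ m<b b≤m)
... | after m<a    | before d≤m   = ⊥-elim (<⇒≱ (<-trans m<a (<-trans a<b b<d)) d≤m)
... | after m<a    | around b≤m _ = ⊥-elim (<⇒≱ (<-trans m<a a<b) b≤m)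
... | around _ m<b | before d≤m   = ⊥-elim (<⇒≱ (<-trans m<b b<d) d≤m)
... | around _ m<b | around b≤m _ = ⊥-elim (<⇒≱ m<b b≤m)

length-spokes : ∀ lo l → length (spokes lo l) ≡ l
length-spokes lo l = begin
  length (spokesBelow lo l ++ spokesAbove lo l)         ≡⟨ length-++ (spokesBelow lo l) ⟩
  length (spokesBelow lo l) + length (spokesAbove lo l) ≡⟨ cong₂ _+_ (length-range (_, mid lo l) lo ⌊ l /2⌋)
                                                             (length-range (mid lo l ,_) (suc (mid lo l)) ⌈ l /2⌉) ⟩
  ⌊ l /2⌋ + ⌈ l /2⌉                                     ≡⟨ ⌊n/2⌋+⌈n/2⌉≡n l ⟩
  l                                                     ∎
  where
  open ≡-Reasoning
  length-range : ∀ (g : ℕ → ℕ × ℕ) lo k → length (map g (range lo k)) ≡ k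
  length-range g lo k = trans (length-map g (range lo k)) (length-applyUpTo (lo +_) k)

halving-step : ∀ l → l + l * (⌈log₂ suc l ⌉ ∸ 1) ≤ suc l * ⌈log₂ suc l ⌉
halving-step zero        = z≤n
halving-step l@(suc _) = begin
  l + l * (K ∸ 1)   ≡⟨ sym (*-suc l (K ∸ 1)) ⟩
  l * suc (K ∸ 1)   ≡⟨ cong (l *_) (m+[n∸m]≡n 1≤K) ⟩
  l * K             ≤⟨ *-monoˡ-≤ K (n≤1+n l) ⟩
  suc l * K         ∎
  where
  open ≤-Reasoning
  K = ⌈log₂ suc l ⌉
  1≤K : 1 ≤ K
  1≤K = ⌈log₂⌉-mono-≤ {2} {suc l} (s≤s (s≤s z≤n))

length-starEdges : ∀ f lo len → len ≤ f → length (starEdges f lo len) ≤ len * ⌈log₂ len ⌉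
length-starEdges zero    lo zero    _         = z≤n
length-starEdges (suc f) lo zero    _         = z≤n
length-starEdges (suc f) lo (suc l) (s≤s l≤f) = begin
  length (spokes lo l ++ (left ++ right))       ≡⟨ length-++ (spokes lo l) ⟩
  length (spokes lo l) + length (left ++ right) ≡⟨ cong₂ _+_ (length-spokes lo l) (length-++ left) ⟩
  l + (length left + length right)              ≤⟨ +-monoʳ-≤ l (+-mono-≤ left-bound right-bound) ⟩
  l + (⌊ l /2⌋ * K′ + ⌈ l /2⌉ * K′)             ≡⟨ cong (l +_) (sym (*-distribʳ-+ K′ ⌊ l /2⌋ ⌈ l /2⌉)) ⟩
  l + (⌊ l /2⌋ + ⌈ l /2⌉) * K′                  ≡⟨ cong (λ k → l + k * K′) (⌊n/2⌋+⌈n/2⌉≡n l) ⟩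
  l + l * K′                                    ≡⟨ cong (λ k → l + l * k) (⌈log₂⌈n/2⌉⌉≡⌈log₂n⌉∸1 (suc l)) ⟩
  l + l * (⌈log₂ suc l ⌉ ∸ 1)                   ≤⟨ halving-step l ⟩
  suc l * ⌈log₂ suc l ⌉                         ∎
  where
  open ≤-Reasoning
  K′ = ⌈log₂ ⌈ suc l /2⌉ ⌉
  left  = starEdges f lo ⌊ l /2⌋
  right = starEdges f (suc (mid lo l)) ⌈ l /2⌉
  left-bound : length left ≤ ⌊ l /2⌋ * K′
  left-bound = ≤-trans (length-starEdges f lo ⌊ l /2⌋ (≤-trans (⌊n/2⌋≤n l) l≤f))
                       (*-monoʳ-≤ ⌊ l /2⌋ (⌈log₂⌉-mono-≤ (n≤1+n ⌊ l /2⌋)))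
  right-bound : length right ≤ ⌈ l /2⌉ * K′
  right-bound = ≤-trans (length-starEdges f (suc (mid lo l)) ⌈ l /2⌉ (≤-trans (⌈n/2⌉≤n l) l≤f))
                        (*-monoʳ-≤ ⌈ l /2⌉ (⌈log₂⌉-mono-≤ (⌈n/2⌉-mono (n≤1+n l))))

starGraph : (n : ℕ) → Graph n
starGraph n = pairsGraph n (starEdges n 0 n)

numEdges-starGraph : ∀ n → numEdges (starGraph n) ≤ n * ⌈log₂ n ⌉
numEdges-starGraph n = ≤-trans (numEdges-pairsGraph n (starEdges n 0 n)) (length-starEdges n 0 n ≤-refl)

starGraph-hubs : ∀ n → IntervalHubs (starGraph n)
starGraph-hubs n = record
  { hub         = starHub n 0 n
  ; hub-within  = starHub-within n 0 n
  ; hub-adj     = λ {a} {b} {x} {y} b≤n x≡hub a≤y y<b x≢y →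
      Adjacent⇒Adj (subst (λ h → Adjacent (starEdges n 0 n) h (toℕ y)) (sym x≡hub)
        (starHub-adj n 0 n ≤-refl z≤n a≤y y<b b≤n
          (λ y≡hub → x≢y (toℕ-injective (trans x≡hub (sym y≡hub))))))
  ; hub-adj-hub = λ {a} {b} {d} {x} {y} a<b b<d d≤n x≡hub y≡hub →
      Adjacent⇒Adj (subst₂ (Adjacent (starEdges n 0 n)) (sym x≡hub) (sym y≡hub)
        (starHub-adj-hub n 0 n ≤-refl z≤n a<b b<d d≤n))
  }

theorem4 : ∃[ C ] ((n : ℕ) → Σ (Graph n) λ G → (numEdges G ≤ C * n * ⌈log₂ n ⌉) × UniversalForCaterpillars G)
theorem4 = 1 , λ n → starGraph n , edge-bound n , caterpillar-universal (starGraph-hubs n)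
  where
  edge-bound : ∀ n → numEdges (starGraph n) ≤ 1 * n * ⌈log₂ n ⌉
  edge-bound n = subst (λ m → numEdges (starGraph n) ≤ m * ⌈log₂ n ⌉) (sym (*-identityˡ n)) (numEdges-starGraph n)
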